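{- A graph $H$ is a $PCP$-graph (i.e., $H$ is isomorphic to the paired coalition graph $PCG(P_n,\pi)$ for some path $P_n$ and some $pc$-partition $\pi$ of $P_n$) if and only if $H\in\{P_2,P_3\}$ (up to isomorphism).
   Context: All graphs are finite, simple and undirected. A paired dominating set of $G$ is a dominating set $S$ of $G$ such that $G[S]$ has a perfect matching. Two disjoint sets $V_1,V_2\subseteq V(G)$ form a paired coalition ($pc$-partners) if neither is a paired dominating set but $V_1\cup V_2$ is. A $pc$-partition of $G$ is a partition $\pi=\{V_1,\dots,V_k\}$ of $V(G)$ into nonempty sets, none of which is a paired dominating set, such that every $V_i$ forms a paired coalition with some other $V_j\in\pi$. The paired coalition graph $PCG(G,\pi)$ has vertex set $\{v_1,\dots,v_k\}$, with $v_i$ adjacent to $v_j$ if and only if $V_i$ and $V_j$ form a paired coalition. $P_n$ denotes the path on $n$ vertices. -}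

module Defs where

open import Data.Nat using (ℕ; zero; suc; _+_; _≥_)
open import Data.Nat.Properties using (1+n≢n; +-comm)
open import Data.Fin using (Fin; toℕ)
open import Data.Product using (Σ; Σ-syntax; ∃; ∃-syntax; _×_; _,_)
open import Data.Sum using (_⊎_; inj₁; inj₂)
open import Data.Empty using (⊥)
open import Relation.Nullary using (¬_)
open import Relation.Binary.PropositionalEquality using (_≡_; _≢_; trans; sym; cong)

record Graph : Set₁ where
  field
    order   : ℕ
    Adj     : Fin order → Fin order → Set
    adjSym  : ∀ {u v} → Adj u v → Adj v u
    adjIrr  : ∀ {v} → ¬ Adj v v
open Graph public

VSet : ℕ → Set₁
VSet n = Fin n → Set

_∪_ : ∀ {n} → VSet n → VSet n → VSet n
(S ∪ T) v = S v ⊎ T v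

Disjoint : ∀ {n} → VSet n → VSet n → Set
Disjoint {n} S T = (v : Fin n) → S v → T v → ⊥

module _ (G : Graph) where
  Dominating : VSet (order G) → Set
  Dominating S = (v : Fin (order G)) → S v ⊎ (Σ[ u ∈ Fin (order G) ] (S u × Adj G u v))

  -- G[S] has a perfect matching: a fixed-point-free involution m on S
  -- pairing each vertex of S with an adjacent vertex of S.
  HasPerfectMatching : VSet (order G) → Set
  HasPerfectMatching S =
    Σ[ m ∈ (Fin (order G) → Fin (order G)) ]
      ((v : Fin (order G)) → S v → S (m v) × Adj G v (m v) × m (m v) ≡ v)

  PairedDominating : VSet (order G) → Set
  PairedDominating S = Dominating S × HasPerfectMatching S

  PairedCoalition : VSet (order G) → VSet (order G) → Set
  PairedCoalition V₁ V₂ =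
    Disjoint V₁ V₂ × ¬ PairedDominating V₁ × ¬ PairedDominating V₂
      × PairedDominating (V₁ ∪ V₂)

  -- Partitions of V(G) into k parts, given by the part-assignment map.
  Part : ∀ {k} → (Fin (order G) → Fin k) → Fin k → VSet (order G)
  Part π i v = π v ≡ i

  IsPCPartition : ∀ {k} → (Fin (order G) → Fin k) → Set
  IsPCPartition {k} π =
    ((i : Fin k) → ∃[ v ] (π v ≡ i))
    × ((i : Fin k) → ¬ PairedDominating (Part π i))
    × ((i : Fin k) → Σ[ j ∈ Fin k ] (j ≢ i × PairedCoalition (Part π i) (Part π j)))

  PCGAdj : ∀ {k} → (Fin (order G) → Fin k) → Fin k → Fin k → Set
  PCGAdj π i j = i ≢ j × PairedCoalition (Part π i) (Part π j)

IsoTo : (H : Graph) (k : ℕ) → (Fin k → Fin k → Set) → Set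
IsoTo H k E =
  Σ[ f ∈ (Fin (order H) → Fin k) ] Σ[ g ∈ (Fin k → Fin (order H)) ]
    (((v : Fin (order H)) → g (f v) ≡ v)
    × ((w : Fin k) → f (g w) ≡ w)
    × ((u v : Fin (order H)) → (Adj H u v → E (f u) (f v)) × (E (f u) (f v) → Adj H u v)))

_≅_ : Graph → Graph → Set
H ≅ G = IsoTo H (order G) (Adj G)

PathAdj : (n : ℕ) → Fin n → Fin n → Set
PathAdj n i j = suc (toℕ i) ≡ toℕ j ⊎ suc (toℕ j) ≡ toℕ i

private
  pathSym : ∀ {n} {i j : Fin n} → PathAdj n i j → PathAdj n j i
  pathSym (inj₁ p) = inj₂ p
  pathSym (inj₂ p) = inj₁ p

  pathIrr : ∀ {n} {i : Fin n} → ¬ PathAdj n i i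
  pathIrr (inj₁ p) = 1+n≢n p
  pathIrr (inj₂ p) = 1+n≢n p

P : ℕ → Graph
P n = record { order = n ; Adj = PathAdj n ; adjSym = pathSym ; adjIrr = pathIrr }

IsPCPGraph : Graph → Set
IsPCPGraph H =
  Σ[ n ∈ ℕ ] (n ≥ 1 × Σ[ k ∈ ℕ ] Σ[ π ∈ (Fin n → Fin k) ]
    (IsPCPartition (P n) π × IsoTo H k (PCGAdj (P n) π)))

{-# OPTIONS --safe #-}
-- The first vertex of a path has a single neighbour, so every paired dominating set contains the
-- second vertex; hence every paired coalition of a pc-partition involves the part of that vertex,
-- and PCG(Pₙ, π) is a star. The star has at most two leaves: if A ∪ B, A ∪ C and A ∪ D are paired
-- dominating for pairwise disjoint B, C, D, then so is A, because a vertex of a path has at most two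
-- neighbours, so at each vertex of A two of the three matchings agree, and their common choice
-- matches A. Conversely, the singleton partitions of P₂ and P₃ have P₂ and P₃ as their PCGs.
module Submission where

open import Defs
open import Data.Nat using (ℕ; zero; suc; s≤s; z≤n)
open import Data.Nat.Properties using (suc-injective)
open import Data.Fin using (Fin; zero; suc; toℕ; inject₁)
open import Data.Fin.Properties using (toℕ-injective; toℕ-inject₁; any?; _≟_)
open import Data.Product using (Σ-syntax; ∃; ∃-syntax; _×_; _,_; proj₁; proj₂; map₁; map₂)
open import Data.Sum as Sum using (_⊎_; inj₁; inj₂)
open import Data.Empty using (⊥-elim)
open import Function using (id; _∘_)
open import Function.Bundles using (_⇔_; mk⇔; Equivalence)
open import Relation.Nullary using (¬_; yes; no)
open import Relation.Nullary.Decidable using (_×-dec_; ¬?)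
open import Relation.Binary.PropositionalEquality using (_≡_; _≢_; refl; sym; trans; cong; subst; subst₂)

open Equivalence using (to; from)

-- Part G id u is ⁅ u ⁆ definitionally.
⁅_⁆ : ∀ {n} → Fin n → VSet n
⁅ u ⁆ v = v ≡ u

module _ {n : ℕ} where

  TwoEqual : Fin n → Fin n → Fin n → Set
  TwoEqual x y z = x ≡ y ⊎ x ≡ z ⊎ y ≡ z

  TwoOf : Fin n → Fin n → Fin n → Fin n → Set
  TwoOf t x y z = (x ≡ t × y ≡ t) ⊎ (x ≡ t × z ≡ t) ⊎ (y ≡ t × z ≡ t)

  majority : Fin n → Fin n → Fin n → Fin n
  majority x y z with x ≟ y
  ... | yes _ = x
  ... | no _ = z

  majority-twoOf : ∀ {t x y z} → TwoOf t x y z → majority x y z ≡ t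
  majority-twoOf {x = x} {y} two with x ≟ y | two
  ... | yes _   | inj₁ (x≡t , _)        = x≡t
  ... | yes _   | inj₂ (inj₁ (x≡t , _)) = x≡t
  ... | yes x≡y | inj₂ (inj₂ (y≡t , _)) = trans x≡y y≡t
  ... | no x≢y  | inj₁ (x≡t , y≡t)      = ⊥-elim (x≢y (trans x≡t (sym y≡t)))
  ... | no _    | inj₂ (inj₁ (_ , z≡t)) = z≡t
  ... | no _    | inj₂ (inj₂ (_ , z≡t)) = z≡t

  twoOf⇒twoOf-majority : ∀ {t x y z} → TwoOf t x y z → TwoOf (majority x y z) x y z
  twoOf⇒twoOf-majority {x = x} {y} {z} two = subst (λ t → TwoOf t x y z) (sym (majority-twoOf two)) two

  twoEqual⇒twoOf-majority : ∀ {x y z} → TwoEqual x y z → TwoOf (majority x y z) x y z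
  twoEqual⇒twoOf-majority (inj₁ x≡y)        = twoOf⇒twoOf-majority (inj₁ (refl , sym x≡y))
  twoEqual⇒twoOf-majority (inj₂ (inj₁ x≡z)) = twoOf⇒twoOf-majority (inj₂ (inj₁ (refl , sym x≡z)))
  twoEqual⇒twoOf-majority (inj₂ (inj₂ y≡z)) = twoOf⇒twoOf-majority (inj₂ (inj₂ (refl , sym y≡z)))

module _ (G : Graph) where

  MaxDegree≤2 : Set
  MaxDegree≤2 = ∀ {w x y z} → Adj G w x → Adj G w y → Adj G w z → TwoEqual x y z

  NoIsolated : Set
  NoIsolated = ∀ u → ∃ (Adj G u)

  isolated⇒¬pairedDominating : ∀ {z S} → (∀ {v} → ¬ Adj G z v) → ¬ PairedDominating G S
  isolated⇒¬pairedDominating {z} isolated (dom , m , matched) with dom z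
  ... | inj₁ z∈S = isolated (proj₁ (proj₂ (matched z z∈S)))
  ... | inj₂ (_ , _ , u~z) = isolated (adjSym G u~z)

  pendantNeighbour∈pairedDominating : ∀ {z u S} → (∀ {v} → Adj G z v → v ≡ u) →
    PairedDominating G S → S u
  pendantNeighbour∈pairedDominating {z} {S = S} only (dom , m , matched) with dom z
  ... | inj₁ z∈S = let (mz∈S , z~mz , _) = matched z z∈S in subst S (only z~mz) mz∈S
  ... | inj₂ (v , v∈S , v~z) = subst S (only (adjSym G v~z)) v∈S

  pairedDominating-∪-comm : ∀ {S T} → PairedDominating G (S ∪ T) → PairedDominating G (T ∪ S)
  pairedDominating-∪-comm (dom , m , matched) =
    (Sum.map Sum.swap (map₂ (map₁ Sum.swap)) ∘ dom) ,
    m , (λ v → map₁ Sum.swap ∘ matched v ∘ Sum.swap)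

  pairedCoalition-sym : ∀ {S T} → PairedCoalition G S T → PairedCoalition G T S
  pairedCoalition-sym (disjoint , ¬pdS , ¬pdT , pd) =
    (λ v t s → disjoint v s t) , ¬pdT , ¬pdS , pairedDominating-∪-comm pd

  singleton-¬pairedDominating : ∀ {u} → ¬ PairedDominating G ⁅ u ⁆
  singleton-¬pairedDominating {u} (_ , m , matched) =
    let (mu≡u , u~mu , _) = matched u refl in adjIrr G (subst (Adj G u) mu≡u u~mu)

  pairedDominatingPair⇒adjacent : ∀ {u v} → PairedDominating G (⁅ u ⁆ ∪ ⁅ v ⁆) → Adj G u v
  pairedDominatingPair⇒adjacent {u} (_ , m , matched) with matched u (inj₁ refl)
  ... | inj₁ mu≡u , u~mu , _ = ⊥-elim (adjIrr G (subst (Adj G u) mu≡u u~mu))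
  ... | inj₂ mu≡v , u~mu , _ = subst (Adj G u) mu≡v u~mu

  adjacentPair-perfectMatching : ∀ {u v} → Adj G u v → HasPerfectMatching G (⁅ u ⁆ ∪ ⁅ v ⁆)
  adjacentPair-perfectMatching {u} {v} u~v = other , matched
    where
      other : Fin (order G) → Fin (order G)
      other x with x ≟ u
      ... | yes _ = v
      ... | no _ = u

      other-u : other u ≡ v
      other-u with u ≟ u
      ... | yes _ = refl
      ... | no u≢u = ⊥-elim (u≢u refl)

      other-v : other v ≡ u
      other-v with v ≟ u
      ... | yes refl = ⊥-elim (adjIrr G u~v)
      ... | no _ = refl

      matched : ∀ x → (⁅ u ⁆ ∪ ⁅ v ⁆) x →
        (⁅ u ⁆ ∪ ⁅ v ⁆) (other x) × Adj G x (other x) × other (other x) ≡ x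
      matched x (inj₁ refl) =
        inj₂ other-u , subst (Adj G u) (sym other-u) u~v , trans (cong other other-u) other-v
      matched x (inj₂ refl) =
        inj₁ other-v , subst (Adj G v) (sym other-v) (adjSym G u~v) , trans (cong other other-v) other-u

  universalVertex⇒dominating : ∀ {c S} → (∀ v → v ≢ c → Adj G c v) → S c → Dominating G S
  universalVertex⇒dominating {c} universal c∈S v with v ≟ c
  ... | yes refl = inj₁ c∈S
  ... | no v≢c = inj₂ (c , c∈S , universal v v≢c)

≅-trans : ∀ {H G K} → H ≅ G → G ≅ K → H ≅ K
≅-trans (f , g , gf , fg , adj) (f′ , g′ , gf′ , fg′ , adj′) =
  f′ ∘ f , g ∘ g′ ,
  (λ v → trans (cong g (gf′ (f v))) (gf v)) ,
  (λ w → trans (cong f′ (fg (g′ w))) (fg′ w)) ,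
  λ u v → proj₁ (adj′ (f u) (f v)) ∘ proj₁ (adj u v) , proj₂ (adj u v) ∘ proj₂ (adj′ (f u) (f v))

enumeration⇒≅ : ∀ {G K} (ψ : Fin (order K) → Fin (order G)) →
  (∀ {x y} → ψ x ≡ ψ y → x ≡ y) → (∀ v → ∃[ x ] ψ x ≡ v) →
  (∀ x y → Adj K x y ⇔ Adj G (ψ x) (ψ y)) → G ≅ K
enumeration⇒≅ {G} ψ injective surjective adj =
  f , ψ , ψ∘f , (λ x → injective (ψ∘f (ψ x))) ,
  λ u v → from (adj (f u) (f v)) ∘ subst₂ (Adj G) (sym (ψ∘f u)) (sym (ψ∘f v)) ,
          subst₂ (Adj G) (ψ∘f u) (ψ∘f v) ∘ to (adj (f u) (f v))
  where
    f = proj₁ ∘ surjective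
    ψ∘f = proj₂ ∘ surjective

module ThreePartners (G : Graph) (maxDegree≤2 : MaxDegree≤2 G) {A B C D : VSet (order G)}
  (B#C : Disjoint B C) (B#D : Disjoint B D) (C#D : Disjoint C D)
  (pdB : PairedDominating G (A ∪ B)) (pdC : PairedDominating G (A ∪ C))
  (pdD : PairedDominating G (A ∪ D)) where

  private
    V = Fin (order G)

    DominatedBy : VSet (order G) → V → Set
    DominatedBy S w = S w ⊎ Σ[ u ∈ V ] (S u × Adj G u w)

    dominatedBy-A-or-neighbourIn : ∀ {X} → PairedDominating G (A ∪ X) → ∀ w →
      DominatedBy A w ⊎ Σ[ u ∈ V ] (X u × Adj G w u)
    dominatedBy-A-or-neighbourIn (dom , m , matched) w with dom w
    ... | inj₁ (inj₁ w∈A) = inj₁ (inj₁ w∈A)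
    ... | inj₁ (inj₂ w∈X) with matched w (inj₂ w∈X)
    ...   | inj₁ mw∈A , w~mw , _ = inj₁ (inj₂ (m w , mw∈A , adjSym G w~mw))
    ...   | inj₂ mw∈X , w~mw , _ = inj₂ (m w , mw∈X , w~mw)
    dominatedBy-A-or-neighbourIn _ w | inj₂ (u , inj₁ u∈A , u~w) = inj₁ (inj₂ (u , u∈A , u~w))
    dominatedBy-A-or-neighbourIn _ w | inj₂ (u , inj₂ u∈X , u~w) = inj₂ (u , u∈X , adjSym G u~w)

    ¬twoEqual : ∀ {x y z} → B x → C y → D z → ¬ TwoEqual x y z
    ¬twoEqual x∈B y∈C z∈D (inj₁ refl)        = B#C _ x∈B y∈C
    ¬twoEqual x∈B y∈C z∈D (inj₂ (inj₁ refl)) = B#D _ x∈B z∈D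
    ¬twoEqual x∈B y∈C z∈D (inj₂ (inj₂ refl)) = C#D _ y∈C z∈D

  dominating : Dominating G A
  dominating w
    with dominatedBy-A-or-neighbourIn pdB w | dominatedBy-A-or-neighbourIn pdC w
       | dominatedBy-A-or-neighbourIn pdD w
  ... | inj₁ dom | _ | _ = dom
  ... | _ | inj₁ dom | _ = dom
  ... | _ | _ | inj₁ dom = dom
  ... | inj₂ (_ , x∈B , w~x) | inj₂ (_ , y∈C , w~y) | inj₂ (_ , z∈D , w~z) =
    ⊥-elim (¬twoEqual x∈B y∈C z∈D (maxDegree≤2 w~x w~y w~z))

  private
    ∪-meet : ∀ {X Y w} → Disjoint X Y → (A ∪ X) w → (A ∪ Y) w → A w
    ∪-meet _ (inj₁ w∈A) _ = w∈A
    ∪-meet _ (inj₂ _) (inj₁ w∈A) = w∈A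
    ∪-meet X#Y (inj₂ w∈X) (inj₂ w∈Y) = ⊥-elim (X#Y _ w∈X w∈Y)

    matchedAt : ∀ {X} (pd : PairedDominating G (A ∪ X)) {v w} → A v → proj₁ (proj₂ pd) v ≡ w →
      (A ∪ X) w × Adj G v w × proj₁ (proj₂ pd) w ≡ v
    matchedAt (_ , _ , matched) v∈A refl = matched _ (inj₁ v∈A)

    sharedPartner : ∀ {X Y} (pdX : PairedDominating G (A ∪ X)) (pdY : PairedDominating G (A ∪ Y)) →
      Disjoint X Y → ∀ {v w} → A v → proj₁ (proj₂ pdX) v ≡ w → proj₁ (proj₂ pdY) v ≡ w →
      A w × Adj G v w × proj₁ (proj₂ pdX) w ≡ v × proj₁ (proj₂ pdY) w ≡ v
    sharedPartner pdX pdY X#Y v∈A eqX eqY =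
      let (w∈A∪X , v~w , mXw≡v) = matchedAt pdX v∈A eqX
          (w∈A∪Y , _ , mYw≡v) = matchedAt pdY v∈A eqY
      in ∪-meet X#Y w∈A∪X w∈A∪Y , v~w , mXw≡v , mYw≡v

    partnerAdjacent : ∀ {X} (pd : PairedDominating G (A ∪ X)) {v} → A v → Adj G v (proj₁ (proj₂ pd) v)
    partnerAdjacent pd v∈A = proj₁ (proj₂ (matchedAt pd v∈A refl))

    mB mC mD mA : V → V
    mB = proj₁ (proj₂ pdB)
    mC = proj₁ (proj₂ pdC)
    mD = proj₁ (proj₂ pdD)
    mA v = majority (mB v) (mC v) (mD v)

    -- The two matchings that agree on v ↦ w also agree on w ↦ v, so mA w = v.
    matchedA : ∀ v → A v → A (mA v) × Adj G v (mA v) × mA (mA v) ≡ v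
    matchedA v v∈A =
      let (w∈A , v~w , back) = fromTwoOf (twoEqual⇒twoOf-majority
            (maxDegree≤2 (partnerAdjacent pdB v∈A) (partnerAdjacent pdC v∈A) (partnerAdjacent pdD v∈A)))
      in w∈A , v~w , majority-twoOf back
      where
        fromTwoOf : TwoOf (mA v) (mB v) (mC v) (mD v) →
          A (mA v) × Adj G v (mA v) × TwoOf v (mB (mA v)) (mC (mA v)) (mD (mA v))
        fromTwoOf (inj₁ (b , c)) =
          let (w∈A , v~w , b′ , c′) = sharedPartner pdB pdC B#C v∈A b c
          in w∈A , v~w , inj₁ (b′ , c′)
        fromTwoOf (inj₂ (inj₁ (b , d))) =
          let (w∈A , v~w , b′ , d′) = sharedPartner pdB pdD B#D v∈A b d
          in w∈A , v~w , inj₂ (inj₁ (b′ , d′))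
        fromTwoOf (inj₂ (inj₂ (c , d))) =
          let (w∈A , v~w , c′ , d′) = sharedPartner pdC pdD C#D v∈A c d
          in w∈A , v~w , inj₂ (inj₂ (c′ , d′))

  pairedDominating : PairedDominating G A
  pairedDominating = dominating , mA , matchedA

PCG : (G : Graph) {k : ℕ} → (Fin (order G) → Fin k) → Graph
PCG G {k} π = record
  { order = k
  ; Adj = PCGAdj G π
  ; adjSym = λ (i≢j , coalition) → (λ j≡i → i≢j (sym j≡i)) , pairedCoalition-sym G coalition
  ; adjIrr = λ (i≢i , _) → i≢i refl
  }

module _ (G : Graph) {k : ℕ} (π : Fin (order G) → Fin k) where

  part-disjoint : ∀ {i j} → i ≢ j → Disjoint (Part G π i) (Part G π j)
  part-disjoint i≢j v πv≡i πv≡j = i≢j (trans (sym πv≡i) πv≡j)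

  PCG-maxDegree≤2 : MaxDegree≤2 G → MaxDegree≤2 (PCG G π)
  PCG-maxDegree≤2 maxDegree≤2 {_} {i} {j} {l}
    (_ , _ , ¬pdX , _ , pdI) (_ , _ , _ , _ , pdJ) (_ , _ , _ , _ , pdL)
    with i ≟ j | i ≟ l | j ≟ l
  ... | yes i≡j | _ | _ = inj₁ i≡j
  ... | _ | yes i≡l | _ = inj₂ (inj₁ i≡l)
  ... | _ | _ | yes j≡l = inj₂ (inj₂ j≡l)
  ... | no i≢j | no i≢l | no j≢l = ⊥-elim (¬pdX (ThreePartners.pairedDominating G maxDegree≤2
    (part-disjoint i≢j) (part-disjoint i≢l) (part-disjoint j≢l) pdI pdJ pdL))

  pcPartition⇒PCG-noIsolated : IsPCPartition G π → NoIsolated (PCG G π)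
  pcPartition⇒PCG-noIsolated (_ , _ , partner) i =
    let (j , j≢i , coalition) = partner i in j , (λ i≡j → j≢i (sym i≡j)) , coalition

module Star (G : Graph) (a : Fin (order G)) (centred : ∀ {u v} → Adj G u v → u ≡ a ⊎ v ≡ a)
  (noIsolated : NoIsolated G) where

  private
    V = Fin (order G)

    leaf-adjacent : ∀ {v} → v ≢ a → Adj G a v
    leaf-adjacent {v} v≢a with noIsolated v
    ... | u , v~u with centred v~u
    ...   | inj₁ v≡a = ⊥-elim (v≢a v≡a)
    ...   | inj₂ refl = adjSym G v~u

    leaves-nonadjacent : ∀ {u v} → u ≢ a → v ≢ a → ¬ Adj G u v
    leaves-nonadjacent u≢a v≢a u~v = Sum.[ u≢a , v≢a ] (centred u~v)

    leaf≢centre : ∀ {c} → Adj G a c → c ≢ a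
    leaf≢centre a~c refl = adjIrr G a~c

    noEdge : ∀ {E : Set} {u v : V} → ¬ E → ¬ Adj G u v → E ⇔ Adj G u v
    noEdge ¬e ¬u~v = mk⇔ (⊥-elim ∘ ¬e) (⊥-elim ∘ ¬u~v)

  ≅P2 : ∀ {c} → c ≢ a → (∀ v → v ≡ a ⊎ v ≡ c) → G ≅ P 2
  ≅P2 {c} c≢a every = enumeration⇒≅ {G} {P 2} ψ injective surjective adjacency
    where
      ψ : Fin 2 → V
      ψ zero = a
      ψ (suc zero) = c

      injective : ∀ {x y} → ψ x ≡ ψ y → x ≡ y
      injective {zero} {zero} _ = refl
      injective {zero} {suc zero} a≡c = ⊥-elim (c≢a (sym a≡c))
      injective {suc zero} {zero} c≡a = ⊥-elim (c≢a c≡a)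
      injective {suc zero} {suc zero} _ = refl

      surjective : ∀ v → ∃[ x ] ψ x ≡ v
      surjective v with every v
      ... | inj₁ v≡a = zero , sym v≡a
      ... | inj₂ v≡c = suc zero , sym v≡c

      adjacency : ∀ x y → PathAdj 2 x y ⇔ Adj G (ψ x) (ψ y)
      adjacency zero zero = noEdge (λ { (inj₁ ()) ; (inj₂ ()) }) (adjIrr G)
      adjacency zero (suc zero) = mk⇔ (λ _ → leaf-adjacent c≢a) (λ _ → inj₁ refl)
      adjacency (suc zero) zero = mk⇔ (λ _ → adjSym G (leaf-adjacent c≢a)) (λ _ → inj₂ refl)
      adjacency (suc zero) (suc zero) = noEdge (λ { (inj₁ ()) ; (inj₂ ()) }) (adjIrr G)

  ≅P3 : ∀ {c d} → c ≢ a → d ≢ a → d ≢ c → (∀ v → v ≡ a ⊎ v ≡ c ⊎ v ≡ d) → G ≅ P 3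
  ≅P3 {c} {d} c≢a d≢a d≢c every = enumeration⇒≅ {G} {P 3} ψ injective surjective adjacency
    where
      ψ : Fin 3 → V
      ψ zero = c
      ψ (suc zero) = a
      ψ (suc (suc zero)) = d

      injective : ∀ {x y} → ψ x ≡ ψ y → x ≡ y
      injective {zero} {zero} _ = refl
      injective {zero} {suc zero} c≡a = ⊥-elim (c≢a c≡a)
      injective {zero} {suc (suc zero)} c≡d = ⊥-elim (d≢c (sym c≡d))
      injective {suc zero} {zero} a≡c = ⊥-elim (c≢a (sym a≡c))
      injective {suc zero} {suc zero} _ = refl
      injective {suc zero} {suc (suc zero)} a≡d = ⊥-elim (d≢a (sym a≡d))
      injective {suc (suc zero)} {zero} d≡c = ⊥-elim (d≢c d≡c)
      injective {suc (suc zero)} {suc zero} d≡a = ⊥-elim (d≢a d≡a)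
      injective {suc (suc zero)} {suc (suc zero)} _ = refl

      surjective : ∀ v → ∃[ x ] ψ x ≡ v
      surjective v with every v
      ... | inj₁ v≡a = suc zero , sym v≡a
      ... | inj₂ (inj₁ v≡c) = zero , sym v≡c
      ... | inj₂ (inj₂ v≡d) = suc (suc zero) , sym v≡d

      adjacency : ∀ x y → PathAdj 3 x y ⇔ Adj G (ψ x) (ψ y)
      adjacency zero zero = noEdge (λ { (inj₁ ()) ; (inj₂ ()) }) (adjIrr G)
      adjacency zero (suc zero) = mk⇔ (λ _ → adjSym G (leaf-adjacent c≢a)) (λ _ → inj₁ refl)
      adjacency zero (suc (suc zero)) = noEdge (λ { (inj₁ ()) ; (inj₂ ()) }) (leaves-nonadjacent c≢a d≢a)
      adjacency (suc zero) zero = mk⇔ (λ _ → leaf-adjacent c≢a) (λ _ → inj₂ refl)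
      adjacency (suc zero) (suc zero) = noEdge (λ { (inj₁ ()) ; (inj₂ ()) }) (adjIrr G)
      adjacency (suc zero) (suc (suc zero)) = mk⇔ (λ _ → leaf-adjacent d≢a) (λ _ → inj₁ refl)
      adjacency (suc (suc zero)) zero = noEdge (λ { (inj₁ ()) ; (inj₂ ()) }) (leaves-nonadjacent d≢a c≢a)
      adjacency (suc (suc zero)) (suc zero) = mk⇔ (λ _ → adjSym G (leaf-adjacent d≢a)) (λ _ → inj₂ refl)
      adjacency (suc (suc zero)) (suc (suc zero)) = noEdge (λ { (inj₁ ()) ; (inj₂ ()) }) (adjIrr G)

  ≅P2⊎P3 : MaxDegree≤2 G → G ≅ P 2 ⊎ G ≅ P 3
  ≅P2⊎P3 maxDegree≤2 with noIsolated a
  ... | c , a~c with any? (λ d → ¬? (d ≟ a) ×-dec ¬? (d ≟ c))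
  ...   | no ¬third = inj₁ (≅P2 (leaf≢centre a~c) only-a-c)
    where
      only-a-c : ∀ v → v ≡ a ⊎ v ≡ c
      only-a-c v with v ≟ a | v ≟ c
      ... | yes v≡a | _ = inj₁ v≡a
      ... | no _ | yes v≡c = inj₂ v≡c
      ... | no v≢a | no v≢c = ⊥-elim (¬third (v , v≢a , v≢c))
  ...   | yes (d , d≢a , d≢c) = inj₂ (≅P3 (leaf≢centre a~c) d≢a d≢c only-a-c-d)
    where
      only-a-c-d : ∀ v → v ≡ a ⊎ v ≡ c ⊎ v ≡ d
      only-a-c-d v with v ≟ a | v ≟ c | v ≟ d
      ... | yes v≡a | _ | _ = inj₁ v≡a
      ... | no _ | yes v≡c | _ = inj₂ (inj₁ v≡c)
      ... | no _ | no _ | yes v≡d = inj₂ (inj₂ v≡d)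
      ... | no v≢a | no v≢c | no v≢d
        with maxDegree≤2 a~c (leaf-adjacent d≢a) (leaf-adjacent v≢a)
      ...   | inj₁ c≡d = ⊥-elim (d≢c (sym c≡d))
      ...   | inj₂ (inj₁ c≡v) = ⊥-elim (v≢c (sym c≡v))
      ...   | inj₂ (inj₂ d≡v) = ⊥-elim (v≢d (sym d≡v))

path-maxDegree≤2 : ∀ n → MaxDegree≤2 (P n)
path-maxDegree≤2 n = neighbours
  where
    right-unique : ∀ {w x y : Fin n} → suc (toℕ w) ≡ toℕ x → suc (toℕ w) ≡ toℕ y → x ≡ y
    right-unique p q = toℕ-injective (trans (sym p) q)

    left-unique : ∀ {w x y : Fin n} → suc (toℕ x) ≡ toℕ w → suc (toℕ y) ≡ toℕ w → x ≡ y
    left-unique p q = toℕ-injective (suc-injective (trans p (sym q)))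

    neighbours : MaxDegree≤2 (P n)
    neighbours (inj₁ p) (inj₁ q) _ = inj₁ (right-unique p q)
    neighbours (inj₂ p) (inj₂ q) _ = inj₁ (left-unique p q)
    neighbours (inj₁ p) _ (inj₁ r) = inj₂ (inj₁ (right-unique p r))
    neighbours (inj₂ p) _ (inj₂ r) = inj₂ (inj₁ (left-unique p r))
    neighbours _ (inj₁ q) (inj₁ r) = inj₂ (inj₂ (right-unique q r))
    neighbours _ (inj₂ q) (inj₂ r) = inj₂ (inj₂ (left-unique q r))

path-noIsolated : ∀ {N} → NoIsolated (P (suc (suc N)))
path-noIsolated zero = suc zero , inj₁ refl
path-noIsolated (suc i) = inject₁ i , inj₂ (cong suc (toℕ-inject₁ i))

path-start-pendant : ∀ {N} {v : Fin (suc (suc N))} → PathAdj _ zero v → v ≡ suc zero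
path-start-pendant (inj₁ p) = toℕ-injective (sym p)

P1-isolated : ∀ {v} → ¬ PathAdj 1 zero v
P1-isolated {zero} (inj₁ ())
P1-isolated {zero} (inj₂ ())

module _ {N k : ℕ} (π : Fin (suc (suc N)) → Fin k) where

  PCG-path-centred : ∀ {i j} → PCGAdj (P (suc (suc N))) π i j → i ≡ π (suc zero) ⊎ j ≡ π (suc zero)
  PCG-path-centred (_ , _ , _ , _ , pd) =
    Sum.map sym sym (pendantNeighbour∈pairedDominating (P _) path-start-pendant pd)

  PCG-path≅P2⊎P3 : IsPCPartition (P (suc (suc N))) π →
    PCG (P (suc (suc N))) π ≅ P 2 ⊎ PCG (P (suc (suc N))) π ≅ P 3
  PCG-path≅P2⊎P3 isPC =
    Star.≅P2⊎P3 (PCG (P _) π) (π (suc zero)) PCG-path-centred (pcPartition⇒PCG-noIsolated (P _) π isPC)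
      (PCG-maxDegree≤2 (P _) π (path-maxDegree≤2 _))

module Singletons (G : Graph) (noIsolated : NoIsolated G)
  (edge-dominating : ∀ {u v} → Adj G u v → Dominating G (⁅ u ⁆ ∪ ⁅ v ⁆)) where

  private
    adjacent⇒coalition : ∀ {u v} → Adj G u v → PCGAdj G id u v
    adjacent⇒coalition u~v =
      (λ { refl → adjIrr G u~v }) ,
      (λ { w refl refl → adjIrr G u~v }) ,
      singleton-¬pairedDominating G , singleton-¬pairedDominating G ,
      edge-dominating u~v , adjacentPair-perfectMatching G u~v

  isPCPartition : IsPCPartition G id
  isPCPartition =
    (λ u → u , refl) , (λ _ → singleton-¬pairedDominating G) ,
    λ u → let (v , u~v) = noIsolated u
          in v , proj₁ (adjacent⇒coalition (adjSym G u~v)) , proj₂ (adjacent⇒coalition u~v)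

  ≅PCG : G ≅ PCG G id
  ≅PCG = enumeration⇒≅ {G} {PCG G id} id id (λ v → v , refl) λ u v →
    mk⇔ (λ (_ , _ , _ , _ , pd) → pairedDominatingPair⇒adjacent G pd) adjacent⇒coalition

P2-edge-dominating : ∀ {u v} → PathAdj 2 u v → Dominating (P 2) (⁅ u ⁆ ∪ ⁅ v ⁆)
P2-edge-dominating {u} _ = universalVertex⇒dominating (P 2) (complete u) (inj₁ refl)
  where
    complete : ∀ x y → y ≢ x → PathAdj 2 x y
    complete zero zero y≢x = ⊥-elim (y≢x refl)
    complete zero (suc zero) _ = inj₁ refl
    complete (suc zero) zero _ = inj₂ refl
    complete (suc zero) (suc zero) y≢x = ⊥-elim (y≢x refl)

P3-middle∈edge : ∀ {u v} → PathAdj 3 u v → u ≡ suc zero ⊎ v ≡ suc zero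
P3-middle∈edge {zero} (inj₁ p) = inj₂ (toℕ-injective (sym p))
P3-middle∈edge {suc zero} _ = inj₁ refl
P3-middle∈edge {suc (suc zero)} (inj₂ p) = inj₂ (toℕ-injective (suc-injective p))
P3-middle∈edge {suc (suc zero)} {zero} (inj₁ ())
P3-middle∈edge {suc (suc zero)} {suc zero} (inj₁ ())
P3-middle∈edge {suc (suc zero)} {suc (suc zero)} (inj₁ ())

P3-middle-universal : ∀ w → w ≢ suc zero → PathAdj 3 (suc zero) w
P3-middle-universal zero _ = inj₂ refl
P3-middle-universal (suc zero) w≢1 = ⊥-elim (w≢1 refl)
P3-middle-universal (suc (suc zero)) _ = inj₁ refl

P3-edge-dominating : ∀ {u v} → PathAdj 3 u v → Dominating (P 3) (⁅ u ⁆ ∪ ⁅ v ⁆)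
P3-edge-dominating u~v =
  universalVertex⇒dominating (P 3) P3-middle-universal (Sum.map sym sym (P3-middle∈edge u~v))

PCPGraph⇒P2⊎P3 : (H : Graph) → IsPCPGraph H → H ≅ P 2 ⊎ H ≅ P 3
PCPGraph⇒P2⊎P3 H (1 , _ , _ , π , (_ , _ , partner) , _) =
  let (_ , _ , _ , _ , _ , pd) = partner (π zero)
  in ⊥-elim (isolated⇒¬pairedDominating (P 1) P1-isolated pd)
PCPGraph⇒P2⊎P3 H (suc (suc N) , _ , _ , π , isPC , H≅PCG) =
  Sum.map (≅-trans {H} {pcg} {P 2} H≅PCG) (≅-trans {H} {pcg} {P 3} H≅PCG) (PCG-path≅P2⊎P3 π isPC)
  where pcg = PCG (P (suc (suc N))) π

path≅⇒PCPGraph : ∀ {H} N →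
  (∀ {u v} → PathAdj (suc (suc N)) u v → Dominating (P (suc (suc N))) (⁅ u ⁆ ∪ ⁅ v ⁆)) →
  H ≅ P (suc (suc N)) → IsPCPGraph H
path≅⇒PCPGraph {H} N edge-dominating H≅P =
  suc (suc N) , s≤s z≤n , suc (suc N) , id , isPCPartition , ≅-trans {H} {P _} {PCG (P _) id} H≅P ≅PCG
  where open Singletons (P (suc (suc N))) path-noIsolated edge-dominating

P2⊎P3⇒PCPGraph : (H : Graph) → H ≅ P 2 ⊎ H ≅ P 3 → IsPCPGraph H
P2⊎P3⇒PCPGraph H =
  Sum.[ path≅⇒PCPGraph {H} 0 P2-edge-dominating , path≅⇒PCPGraph {H} 1 P3-edge-dominating ]

mainTheorem2 : (H : Graph) →
    (IsPCPGraph H → (H ≅ P 2) ⊎ (H ≅ P 3)) × ((H ≅ P 2) ⊎ (H ≅ P 3) → IsPCPGraph H)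
mainTheorem2 H = PCPGraph⇒P2⊎P3 H , P2⊎P3⇒PCPGraph H
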